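{- (i) For integers $p\geq 0$, $s,t\geq 1$ and $\max\{s+p+2,\,t+p+2\}\leq n\leq s+t+p+1$, the nearly balanced graph $M_{n,n-1}^{s,t}$ is not $2p$-Hamilton-biconnected. (ii) For integers $p\geq 0$, $s,t\geq 1$ and $n=s+t+p$, the balanced graph $M_{n,n}^{s,t}$ is not $2p$-Hamilton-biconnected. (iii) For integers $p\geq 0$ and $n\geq p+6$, $N_{n,n}^{p,1}$ is not $2p$-Hamilton-biconnected.
   Context: A bipartite graph $G=(X,Y;E)$ is balanced if $|X|=|Y|$ and nearly balanced if $|X|=|Y|+1$. A balanced bipartite graph is Hamilton-biconnected if for every $u\in X$, $v\in Y$ it has a Hamiltonian path with ends $u,v$; a nearly balanced one is Hamilton-biconnected if for any two distinct $u,v\in X$ it has a Hamiltonian path with ends $u,v$. A set $W\subseteq V(G)$ is balanced if $|W\cap X|=|W\cap Y|$; $G$ is $2p$-Hamilton-biconnected if for every balanced $W$ with $|W|=2p$, the subgraph induced by $V(G)\setminus W$ is Hamilton-biconnected. $M_{n,m}^{s,t}$ denotes the bipartite graph with parts $X=X_1\cup X_2$, $Y=Y_1\cup Y_2$, $|X_1|=s$, $|X_2|=n-s$, $|Y_1|=m-t$, $|Y_2|=t$, whose edges are all pairs between $X_1$ and $Y_1$, between $X_2$ and $Y_1$, and between $X_2$ and $Y_2$. $N_{n,n}^{p,1}$ denotes the balanced bipartite graph with parts $X=X_1\cup X_2\cup X_3$, $Y=Y_1\cup Y_2\cup Y_3$, $|X_1|=|Y_1|=n-p-2$, $|X_2|=|Y_2|=p+1$,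 $|X_3|=|Y_3|=1$, whose edges are all pairs between $X_1$ and $Y_1\cup Y_2$, between $X_2$ and $Y_1\cup Y_2\cup Y_3$, and between $X_3$ and $Y_2\cup Y_3$. -}

module Defs where

open import Data.Nat using (ℕ; _+_; _∸_; _≤_; _<_)
open import Data.Fin using (Fin; toℕ)
open import Data.Fin.Subset using (Subset; _∉_; ∣_∣)
open import Data.Sum using (_⊎_; inj₁; inj₂)
open import Data.Product using (_×_; ∃)
open import Data.Empty using (⊥)
open import Data.List using (List; _∷_; []; _++_)
open import Data.List.Relation.Unary.Linked using (Linked)
open import Data.List.Relation.Unary.All using (All)
open import Data.List.Relation.Unary.Unique.Propositional using (Unique)
import Data.List.Membership.Propositional as LM
open import Relation.Binary.PropositionalEquality using (_≡_; _≢_)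

record BipGraph : Set₁ where
  field
    nX  : ℕ
    nY  : ℕ
    adj : Fin nX → Fin nY → Set

module _ (G : BipGraph) where
  open BipGraph G

  Vertex : Set
  Vertex = Fin nX ⊎ Fin nY

  Adj : Vertex → Vertex → Set
  Adj (inj₁ x) (inj₂ y) = adj x y
  Adj (inj₂ y) (inj₁ x) = adj x y
  Adj (inj₁ _) (inj₁ _) = ⊥
  Adj (inj₂ _) (inj₂ _) = ⊥

  Alive : Subset nX → Subset nY → Vertex → Set
  Alive WX WY (inj₁ x) = x ∉ WX
  Alive WX WY (inj₂ y) = y ∉ WY

  HamPath : Subset nX → Subset nY → Vertex → Vertex → Set
  HamPath WX WY u v =
    ∃ λ (mid : List Vertex) →
      let P = u ∷ (mid ++ (v ∷ [])) in
      Linked Adj P × Unique P × All (Alive WX WY) P ×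
      (∀ w → Alive WX WY w → w LM.∈ P)

  HBBalanced : Subset nX → Subset nY → Set
  HBBalanced WX WY = ∀ (u : Fin nX) (v : Fin nY) → u ∉ WX → v ∉ WY →
    HamPath WX WY (inj₁ u) (inj₂ v)

  HBNearly : Subset nX → Subset nY → Set
  HBNearly WX WY = ∀ (u v : Fin nX) → u ≢ v → u ∉ WX → v ∉ WX →
    HamPath WX WY (inj₁ u) (inj₁ v)

  -- 2p-Hamilton-biconnected: balanced W with |W| = 2p, i.e. |W∩X| = |W∩Y| = p
  2p-HBBalanced : ℕ → Set
  2p-HBBalanced p = ∀ (WX : Subset nX) (WY : Subset nY) →
    ∣ WX ∣ ≡ p → ∣ WY ∣ ≡ p → HBBalanced WX WY

  2p-HBNearly : ℕ → Set
  2p-HBNearly p = ∀ (WX : Subset nX) (WY : Subset nY) →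
    ∣ WX ∣ ≡ p → ∣ WY ∣ ≡ p → HBNearly WX WY

-- M^{s,t}_{n,m}: X1 = {x | toℕ x < s}, X2 = rest; Y1 = {y | toℕ y < m ∸ t}, Y2 = rest.
M : (n m s t : ℕ) → BipGraph
M n m s t = record
  { nX = n ; nY = m
  ; adj = λ x y →
      (toℕ x < s × toℕ y < m ∸ t)
      ⊎ (s ≤ toℕ x × toℕ y < m ∸ t)
      ⊎ (s ≤ toℕ x × m ∸ t ≤ toℕ y)
  }

-- parts of N^{p,1}_{n,n}: indices [0, n-p-2), [n-p-2, n-1), [n-1, n)
Part1 Part2 Part3 : (n p : ℕ) → {k : ℕ} → Fin k → Set
Part1 n p i = toℕ i < n ∸ p ∸ 2
Part2 n p i = n ∸ p ∸ 2 ≤ toℕ i × toℕ i < n ∸ 1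
Part3 n p i = n ∸ 1 ≤ toℕ i

N : (n p : ℕ) → BipGraph
N n p = record
  { nX = n ; nY = n
  ; adj = λ x y →
      (Part1 n p x × (Part1 n p y ⊎ Part2 n p y))
      ⊎ (Part2 n p x × (Part1 n p y ⊎ Part2 n p y ⊎ Part3 n p y))
      ⊎ (Part3 n p x × (Part2 n p y ⊎ Part3 n p y))
  }

module Submission where

open import Defs
open import Data.Nat using (ℕ; zero; suc; _+_; _∸_; _≤_; _<_; _⊔_; z≤n; s≤s; s≤s⁻¹; _≤?_; _<?_)
open import Data.Nat.Properties
  using (≤-refl; ≤-reflexive; ≤-trans; ≤-antisym; <-trans; <-irrefl; <⇒≤; <⇒≱; ≮⇒≥; ≰⇒>; n≮0; n≤1+n; n<1+n;
         1+n≢n; +-assoc; +-comm; +-suc; +-identityʳ; +-mono-≤; +-monoˡ-≤; +-monoʳ-≤; +-monoʳ-<; +-cancelʳ-≤;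
         m≤m+n; m≤n+m; m<m+n; m≤m⊔n; m≤n⊔m; ∸-+-assoc; m+n∸n≡m; m+[n∸m]≡n; m∸n+n≡m; m+n≤o⇒m≤o∸n;
         m≤n+o⇒m∸n≤o; +-commutativeSemigroup; module ≤-Reasoning)
open import Algebra.Properties.CommutativeSemigroup +-commutativeSemigroup using (xy∙z≈xz∙y)
open import Data.Fin using (Fin; zero; suc; toℕ; fromℕ<)
open import Data.Fin.Properties using (suc-injective; toℕ-fromℕ<; toℕ-injective; toℕ<n)
import Data.Fin.Subset as Subset
open Subset using (Subset; inside; outside; _∉_; ∣_∣)
open import Data.Vec using ([]; _∷_; here; there)
open import Data.List using (List; []; _∷_; _++_; [_]; length; map; filter)
open import Data.List.Properties using (length-++; length-map; filter-accept; filter-reject)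
import Data.List.Relation.Unary.All as All
open import Data.List.Relation.Unary.All.Properties using (map⁺)
open import Data.List.Relation.Unary.Any using (here; there)
open import Data.List.Relation.Unary.Linked using (Linked; _∷_)
open import Data.List.Relation.Unary.Unique.Propositional using (Unique; []; _∷_)
import Data.List.Relation.Unary.Unique.Propositional.Properties as Unique
open import Data.List.Membership.Propositional using (_∈_)
open import Data.List.Membership.Propositional.Properties
  using (∈-∃++; ∈-++⁻; ∈-++⁺ˡ; ∈-++⁺ʳ; ∈-filter⁺; ∈-filter⁻; ∈-map⁺; ∈-map⁻)
open import Data.List.Relation.Binary.Subset.Propositional using (_⊆_)
open import Data.Product using (_×_; _,_; proj₁; proj₂; ∃)
open import Data.Sum using (_⊎_; inj₁; inj₂; [_,_]′)
open import Data.Sum.Properties using (inj₁-injective; inj₂-injective)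
open import Data.Empty using (⊥; ⊥-elim)
open import Level using (0ℓ)
open import Relation.Nullary using (¬_; Dec; yes; no)
open import Relation.Nullary.Decidable using (_×-dec_)
open import Relation.Unary using (Pred; Decidable)
open import Relation.Binary using (Rel; Symmetric)
open import Relation.Binary.PropositionalEquality
  using (_≡_; _≢_; refl; sym; trans; cong; cong₂; subst; subst₂; module ≡-Reasoning)

-- Let A be a set of vertices with N(A) ⊆ A ∪ B and A ∩ B = ∅. Along a path, every exit from A
-- (an A-vertex followed by a vertex outside A) enters a B-vertex, and distinct exits enter distinct
-- B-vertices. If the path also visits a vertex outside A ∪ B and ends in B, then after the last such
-- vertex it enters B once more without coming from A; and a path starting in B uses one more B-vertex.
-- So a Hamiltonian path ending in B needs at least exits + [starts in B] + 1 vertices of B.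
-- For each graph we delete a balanced W of size 2p leaving too few B-vertices:
--  (ii)  A = X₁ (independent, s vertices, so at least s exits), B = Y₁ − W with s vertices: s + 1 ≤ s;
--  (i)   A = Y₂ (independent, t vertices), B = X₂ − W with at most t + 1 vertices containing both
--        ends of the path: t + 2 ≤ t + 1;
--  (iii) A = X₃ ∪ Y₃ (met at least once), B = (X₂ ∪ Y₂) − W, which is just the two ends: 3 ≤ 2.

module _ {A : Set} where

  Unique-⊆⇒length≤ : {xs ys : List A} → Unique xs → xs ⊆ ys → length xs ≤ length ys
  Unique-⊆⇒length≤ {[]}     _            _     = z≤n
  Unique-⊆⇒length≤ {x ∷ xs} (x∉xs ∷ !xs) xs⊆ys
    with ys₁ , ys₂ , refl ← ∈-∃++ (xs⊆ys (here refl)) =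
    subst (suc (length xs) ≤_) length-removed
      (s≤s (Unique-⊆⇒length≤ !xs λ z∈xs → avoid-x (All.lookup x∉xs z∈xs) (xs⊆ys (there z∈xs))))
    where
    length-removed : suc (length (ys₁ ++ ys₂)) ≡ length (ys₁ ++ x ∷ ys₂)
    length-removed rewrite length-++ ys₁ {ys₂} | length-++ ys₁ {x ∷ ys₂} = sym (+-suc _ _)
    avoid-x : ∀ {z} → x ≢ z → z ∈ ys₁ ++ x ∷ ys₂ → z ∈ ys₁ ++ ys₂
    avoid-x x≢z z∈ with ∈-++⁻ ys₁ z∈
    ... | inj₁ z∈ys₁         = ∈-++⁺ˡ z∈ys₁
    ... | inj₂ (here refl)   = ⊥-elim (x≢z refl)
    ... | inj₂ (there z∈ys₂) = ∈-++⁺ʳ ys₁ z∈ys₂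

  module _ {ℓ} {P : Pred A ℓ} (P? : Decidable P) where

    count : List A → ℕ
    count xs = length (filter P? xs)

    count-∷ : ∀ x xs → count (x ∷ xs) ≡ count [ x ] + count xs
    count-∷ x xs with P? x
    ... | yes _ = refl
    ... | no  _ = refl

    count-[]≡1 : ∀ {x} → P x → count [ x ] ≡ 1
    count-[]≡1 Px = cong length (filter-accept P? Px)

    count-[]≡0 : ∀ {x} → ¬ P x → count [ x ] ≡ 0
    count-[]≡0 ¬Px = cong length (filter-reject P? ¬Px)

    count≤length : ∀ {xs} ys → Unique xs → (∀ {z} → z ∈ xs → P z → z ∈ ys) → count xs ≤ length ys
    count≤length ys !xs sel = Unique-⊆⇒length≤ (Unique.filter⁺ P? !xs) λ z∈ →
      let z∈xs , Pz = ∈-filter⁻ P? z∈ in sel z∈xs Pz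

    length≤count : ∀ xs {ys} → Unique ys → (∀ {z} → z ∈ ys → z ∈ xs × P z) → length ys ≤ count xs
    length≤count xs !ys sel = Unique-⊆⇒length≤ !ys λ z∈ →
      let z∈xs , Pz = sel z∈ in ∈-filter⁺ P? z∈xs Pz

interval : (N a k : ℕ) → Subset N
interval zero    _       _       = []
interval (suc N) (suc a) k       = outside ∷ interval N a k
interval (suc N) zero    zero    = outside ∷ interval N zero zero
interval (suc N) zero    (suc k) = inside  ∷ interval N zero k

∣interval∣ : ∀ N a k → a + k ≤ N → ∣ interval N a k ∣ ≡ k
∣interval∣ zero    zero    zero    _           = refl
∣interval∣ (suc N) (suc a) k       (s≤s a+k≤N) = ∣interval∣ N a k a+k≤N
∣interval∣ (suc N) zero    zero    _           = ∣interval∣ N zero zero z≤n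
∣interval∣ (suc N) zero    (suc k) (s≤s k≤N)   = cong suc (∣interval∣ N zero k k≤N)

∈-interval⁻ : ∀ {N a k} {i : Fin N} → i Subset.∈ interval N a k → a ≤ toℕ i × toℕ i < a + k
∈-interval⁻ {suc N} {suc a}        {i = suc i} (there i∈) with a≤i , i<a+k ← ∈-interval⁻ i∈ = s≤s a≤i , s≤s i<a+k
∈-interval⁻ {suc N} {zero} {zero}  {i = suc i} (there i∈) with _ , i<0 ← ∈-interval⁻ i∈   = ⊥-elim (n≮0 i<0)
∈-interval⁻ {suc N} {zero} {suc k} {i = zero}  here                                        = z≤n , s≤s z≤n
∈-interval⁻ {suc N} {zero} {suc k} {i = suc i} (there i∈) with _ , i<k ← ∈-interval⁻ i∈   = z≤n , s≤s i<k

∈-interval⁺ : ∀ {N a k} {i : Fin N} → a ≤ toℕ i → toℕ i < a + k → i Subset.∈ interval N a k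
∈-interval⁺ {suc N} {suc a}        {i = suc i} (s≤s a≤i) (s≤s i<a+k) = there (∈-interval⁺ a≤i i<a+k)
∈-interval⁺ {suc N} {zero} {suc k} {i = zero}  _         _           = here
∈-interval⁺ {suc N} {zero} {suc k} {i = suc i} _         (s≤s i<k)   = there (∈-interval⁺ z≤n i<k)

∉-interval⁺ : ∀ {N a k} {i : Fin N} → toℕ i < a ⊎ a + k ≤ toℕ i → i ∉ interval N a k
∉-interval⁺ (inj₁ i<a)   i∈ with a≤i , _ ← ∈-interval⁻ i∈ = <⇒≱ i<a a≤i
∉-interval⁺ (inj₂ a+k≤i) i∈ with _ , i<a+k ← ∈-interval⁻ i∈ = <⇒≱ i<a+k a+k≤i

∉-interval⁻ : ∀ {N a k} {i : Fin N} → i ∉ interval N a k → toℕ i < a ⊎ a + k ≤ toℕ i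
∉-interval⁻ {a = a} {k} {i} i∉ with toℕ i <? a | a + k ≤? toℕ i
... | yes i<a | _         = inj₁ i<a
... | no _    | yes a+k≤i = inj₂ a+k≤i
... | no i≮a  | no a+k≰i  = ⊥-elim (i∉ (∈-interval⁺ (≮⇒≥ i≮a) (≰⇒> a+k≰i)))

intervalList : (N a k : ℕ) → List (Fin N)
intervalList zero    _       _       = []
intervalList (suc N) (suc a) k       = map suc (intervalList N a k)
intervalList (suc N) zero    zero    = []
intervalList (suc N) zero    (suc k) = zero ∷ map suc (intervalList N zero k)

length-intervalList : ∀ N a k → a + k ≤ N → length (intervalList N a k) ≡ k
length-intervalList zero    zero    zero    _           = refl
length-intervalList (suc N) (suc a) k       (s≤s a+k≤N) =
  trans (length-map suc (intervalList N a k)) (length-intervalList N a k a+k≤N)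
length-intervalList (suc N) zero    zero    _           = refl
length-intervalList (suc N) zero    (suc k) (s≤s k≤N)   =
  cong suc (trans (length-map suc (intervalList N zero k)) (length-intervalList N zero k k≤N))

intervalList-unique : ∀ N a k → Unique (intervalList N a k)
intervalList-unique zero    _       _       = []
intervalList-unique (suc N) (suc a) k       = Unique.map⁺ suc-injective (intervalList-unique N a k)
intervalList-unique (suc N) zero    zero    = []
intervalList-unique (suc N) zero    (suc k) =
  map⁺ (All.universal (λ _ ()) _) ∷ Unique.map⁺ suc-injective (intervalList-unique N zero k)

∈-intervalList⁻ : ∀ {N a k} {i : Fin N} → i ∈ intervalList N a k → a ≤ toℕ i × toℕ i < a + k
∈-intervalList⁻ {suc N} {suc a} i∈ with j , j∈ , refl ← ∈-map⁻ suc i∈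
  with a≤j , j<a+k ← ∈-intervalList⁻ j∈ = s≤s a≤j , s≤s j<a+k
∈-intervalList⁻ {suc N} {zero} {suc k} (here refl) = z≤n , s≤s z≤n
∈-intervalList⁻ {suc N} {zero} {suc k} (there i∈) with j , j∈ , refl ← ∈-map⁻ suc i∈
  with _ , j<k ← ∈-intervalList⁻ j∈ = z≤n , s≤s j<k

∈-intervalList⁺ : ∀ {N a k} {i : Fin N} → a ≤ toℕ i → toℕ i < a + k → i ∈ intervalList N a k
∈-intervalList⁺ {suc N} {suc a}        {i = suc i} (s≤s a≤i) (s≤s i<a+k) = ∈-map⁺ suc (∈-intervalList⁺ a≤i i<a+k)
∈-intervalList⁺ {suc N} {zero} {suc k} {i = zero}  _         _           = here refl
∈-intervalList⁺ {suc N} {zero} {suc k} {i = suc i} _         (s≤s i<k)   =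
  there (∈-map⁺ suc (∈-intervalList⁺ z≤n i<k))

module _ {V : Set} where

  EndsIn : Pred V 0ℓ → V → List V → Set
  EndsIn P x []       = P x
  EndsIn P _ (y ∷ ys) = EndsIn P y ys

  EndsIn-∷ʳ : ∀ {P : Pred V 0ℓ} {v} x xs → P v → EndsIn P x (xs ++ [ v ])
  EndsIn-∷ʳ x []       Pv = Pv
  EndsIn-∷ʳ x (y ∷ ys) Pv = EndsIn-∷ʳ y ys Pv

module Separation {V : Set} {R : Rel V 0ℓ} (R-sym : Symmetric R)
  {A B : Pred V 0ℓ} (A? : Decidable A) (B? : Decidable B)
  (A∩B=∅ : ∀ {x} → A x → ¬ B x)
  (closed : ∀ {x y} → R x y → A x → A y ⊎ B y) where

  exit : V → V → ℕ
  exit x y with A? x | A? y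
  ... | yes _ | no _ = 1
  ... | _     | _    = 0

  exits : List V → ℕ
  exits []           = 0
  exits (x ∷ [])     = 0
  exits (x ∷ y ∷ ys) = exit x y + exits (y ∷ ys)

  exit≤countB : ∀ {x y} → R x y → exit x y ≤ count B? [ y ]
  exit≤countB {x} {y} Rxy with A? x | A? y
  ... | yes _  | yes _  = z≤n
  ... | no _   | _      = z≤n
  ... | yes Ax | no ¬Ay with closed Rxy Ax
  ...   | inj₁ Ay = ⊥-elim (¬Ay Ay)
  ...   | inj₂ By = ≤-reflexive (sym (count-[]≡1 B? By))

  exit-¬A : ∀ {x} y → ¬ A x → exit x y ≡ 0
  exit-¬A {x} y ¬Ax with A? x
  ... | yes Ax = ⊥-elim (¬Ax Ax)
  ... | no _   = refl

  open ≤-Reasoning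

  exits≤countB : ∀ x xs → Linked R (x ∷ xs) → count B? [ x ] + exits (x ∷ xs) ≤ count B? (x ∷ xs)
  exits≤countB x []       _              = ≤-reflexive (+-identityʳ _)
  exits≤countB x (y ∷ ys) (Rxy ∷ linked) = begin
    count B? [ x ] + (exit x y + exits (y ∷ ys))
      ≤⟨ +-monoʳ-≤ (count B? [ x ]) (+-monoˡ-≤ _ (exit≤countB Rxy)) ⟩
    count B? [ x ] + (count B? [ y ] + exits (y ∷ ys))
      ≤⟨ +-monoʳ-≤ (count B? [ x ]) (exits≤countB y ys linked) ⟩
    count B? [ x ] + count B? (y ∷ ys)
      ≡⟨ count-∷ B? x (y ∷ ys) ⟨
    count B? (x ∷ y ∷ ys) ∎

  exits<countB : ∀ x xs → Linked R (x ∷ xs) → EndsIn B x xs → ∀ {c} → c ∈ x ∷ xs → ¬ A c → ¬ B c →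
                 count B? [ x ] + exits (x ∷ xs) < count B? (x ∷ xs)
  exits<countB x [] _ Bx (here refl) _ ¬Bx = ⊥-elim (¬Bx Bx)
  exits<countB x (y ∷ ys) (Rxy ∷ linked) ends (there c∈) ¬Ac ¬Bc = begin-strict
    count B? [ x ] + (exit x y + exits (y ∷ ys))
      ≤⟨ +-monoʳ-≤ (count B? [ x ]) (+-monoˡ-≤ _ (exit≤countB Rxy)) ⟩
    count B? [ x ] + (count B? [ y ] + exits (y ∷ ys))
      <⟨ +-monoʳ-< (count B? [ x ]) (exits<countB y ys linked ends c∈ ¬Ac ¬Bc) ⟩
    count B? [ x ] + count B? (y ∷ ys)
      ≡⟨ count-∷ B? x (y ∷ ys) ⟨
    count B? (x ∷ y ∷ ys) ∎
  exits<countB x (y ∷ ys) (Rxy ∷ linked) ends (here refl) ¬Ax ¬Bx = begin-strict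
    count B? [ x ] + (exit x y + exits (y ∷ ys))
      ≡⟨ cong₂ (λ h e → h + (e + exits (y ∷ ys))) (count-[]≡0 B? ¬Bx) (exit-¬A y ¬Ax) ⟩
    exits (y ∷ ys)
      <⟨ from-successor (B? y) ⟩
    count B? (y ∷ ys)
      ≡⟨ cong (_+ count B? (y ∷ ys)) (count-[]≡0 B? ¬Bx) ⟨
    count B? [ x ] + count B? (y ∷ ys)
      ≡⟨ count-∷ B? x (y ∷ ys) ⟨
    count B? (x ∷ y ∷ ys) ∎
    where
    ¬Ay : ¬ A y
    ¬Ay Ay = [ ¬Ax , ¬Bx ]′ (closed (R-sym Rxy) Ay)
    from-successor : Dec (B y) → exits (y ∷ ys) < count B? (y ∷ ys)
    from-successor (yes By) =
      ≤-trans (≤-reflexive (cong (_+ exits (y ∷ ys)) (sym (count-[]≡1 B? By)))) (exits≤countB y ys linked)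
    from-successor (no ¬By) =
      ≤-trans (≤-reflexive (cong (λ k → suc (k + exits (y ∷ ys))) (sym (count-[]≡0 B? ¬By))))
              (exits<countB y ys linked ends (here refl) ¬Ay ¬By)

  count≤exits : (∀ {x y} → R x y → A x → ¬ A y) →
                ∀ x xs → Linked R (x ∷ xs) → EndsIn B x xs → count A? (x ∷ xs) ≤ exits (x ∷ xs)
  count≤exits _     x []       _              Bx   = ≤-reflexive (count-[]≡0 A? (λ Ax → A∩B=∅ Ax Bx))
  count≤exits indep x (y ∷ ys) (Rxy ∷ linked) ends = begin
    count A? (x ∷ y ∷ ys)              ≡⟨ count-∷ A? x (y ∷ ys) ⟩
    count A? [ x ] + count A? (y ∷ ys) ≤⟨ +-mono-≤ entry≤exit (count≤exits indep y ys linked ends) ⟩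
    exit x y + exits (y ∷ ys)          ∎
    where
    entry≤exit : count A? [ x ] ≤ exit x y
    entry≤exit with A? x | A? y
    ... | yes Ax | yes Ay = ⊥-elim (indep Rxy Ax Ay)
    ... | yes _  | no _   = ≤-refl
    ... | no _   | _      = z≤n

  ∈A⇒0<exits : ∀ x xs → EndsIn B x xs → ∀ {a} → a ∈ x ∷ xs → A a → 0 < exits (x ∷ xs)
  ∈A⇒0<exits x []       Bx   (here refl) Ax = ⊥-elim (A∩B=∅ Ax Bx)
  ∈A⇒0<exits x (y ∷ ys) ends a∈          Aa with A? x | A? y
  ... | yes _  | no _   = s≤s z≤n
  ... | yes _  | yes Ay = ∈A⇒0<exits y ys ends (here refl) Ay
  ... | no ¬Ax | _      with a∈
  ...   | here refl = ⊥-elim (¬Ax Aa)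
  ...   | there a∈′ = ∈A⇒0<exits y ys ends a∈′ Aa

Adj-sym : ∀ G → Symmetric (Adj G)
Adj-sym G {inj₁ _} {inj₂ _} e = e
Adj-sym G {inj₂ _} {inj₁ _} e = e

module OnHamPath (G : BipGraph) {WX WY u v} (path : HamPath G WX WY u v) where

  vertices : List (Vertex G)
  vertices = u ∷ proj₁ path ++ [ v ]

  private
    linked = proj₁ (proj₂ path)
    unique = proj₁ (proj₂ (proj₂ path))
    alive  = proj₁ (proj₂ (proj₂ (proj₂ path)))
    covers = proj₂ (proj₂ (proj₂ (proj₂ path)))

  module _ {Q : Pred (Vertex G) 0ℓ} (Q? : Decidable Q) where

    path-count≤length : ∀ L → (∀ {w} → Alive G WX WY w → Q w → w ∈ L) → count Q? vertices ≤ length L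
    path-count≤length L sel = count≤length Q? L unique λ w∈ → sel (All.lookup alive w∈)

    length≤path-count : ∀ {L} → Unique L → (∀ {w} → w ∈ L → Alive G WX WY w × Q w) → length L ≤ count Q? vertices
    length≤path-count !L sel = length≤count Q? vertices !L λ w∈ →
      let alive-w , Qw = sel w∈ in covers _ alive-w , Qw

    module _ {N} (ι : Fin N → Vertex G) {a k} (a+k≤N : a + k ≤ N) where

      private
        length-ιL : length (map ι (intervalList N a k)) ≡ k
        length-ιL = trans (length-map ι (intervalList N a k)) (length-intervalList N a k a+k≤N)

      interval≤path-count : (∀ {i j} → ι i ≡ ι j → i ≡ j) →
        (∀ {i} → a ≤ toℕ i → toℕ i < a + k → Alive G WX WY (ι i) × Q (ι i)) → k ≤ count Q? vertices
      interval≤path-count ι-injective sel =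
        subst (_≤ count Q? vertices) length-ιL
          (length≤path-count (Unique.map⁺ ι-injective (intervalList-unique N a k)) λ w∈ →
            let i , i∈ , w≡ιi = ∈-map⁻ ι w∈ ; a≤i , i<a+k = ∈-intervalList⁻ i∈ in
            subst (λ w → Alive G WX WY w × Q w) (sym w≡ιi) (sel a≤i i<a+k))

      path-count≤interval : (∀ {w} → Alive G WX WY w → Q w → ∃ λ i → w ≡ ι i × a ≤ toℕ i × toℕ i < a + k) →
        count Q? vertices ≤ k
      path-count≤interval sel =
        subst (count Q? vertices ≤_) length-ιL
          (path-count≤length (map ι (intervalList N a k)) λ alive-w Qw →
            let i , w≡ιi , a≤i , i<a+k = sel alive-w Qw in
            subst (_∈ map ι (intervalList N a k)) (sym w≡ιi) (∈-map⁺ ι (∈-intervalList⁺ a≤i i<a+k)))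

  module Separated {A B : Pred (Vertex G) 0ℓ} (A? : Decidable A) (B? : Decidable B)
    (A∩B=∅ : ∀ {x} → A x → ¬ B x) (closed : ∀ {x y} → Adj G x y → A x → A y ⊎ B y) (Bv : B v) where

    private
      module S = Separation {R = Adj G} (λ {x} {y} → Adj-sym G {x} {y}) A? B? A∩B=∅ closed
      ends : EndsIn B u (proj₁ path ++ [ v ])
      ends = EndsIn-∷ʳ u (proj₁ path) Bv

    open S public using (exits)

    path-exits<countB : ∀ c → Alive G WX WY c → ¬ A c → ¬ B c → count B? [ u ] + exits vertices < count B? vertices
    path-exits<countB _ alive-c = S.exits<countB u _ linked ends (covers _ alive-c)

    path-count≤exits : (∀ {x y} → Adj G x y → A x → ¬ A y) → count A? vertices ≤ exits vertices
    path-count≤exits indep = S.count≤exits indep u _ linked ends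

    path-0<exits : ∀ a → Alive G WX WY a → A a → 0 < exits vertices
    path-0<exits _ alive-a = S.∈A⇒0<exits u _ ends (covers _ alive-a)

module BalancedM (p s t : ℕ) (1≤s : 1 ≤ s) (1≤t : 1 ≤ t) where

  private
    n = s + t + p
    G = M n n s t

    n≡s+p+t : n ≡ s + p + t
    n≡s+p+t = xy∙z≈xz∙y s t p
    n∸t≡s+p : n ∸ t ≡ s + p
    n∸t≡s+p = trans (cong (_∸ t) n≡s+p+t) (m+n∸n≡m (s + p) t)
    s+p<n : s + p < n
    s+p<n = subst (s + p <_) (sym n≡s+p+t) (m<m+n (s + p) 1≤t)
    s≤n : 0 + s ≤ n
    s≤n = ≤-trans (m≤m+n s p) (<⇒≤ s+p<n)
    0<n : 0 < n
    0<n = ≤-trans 1≤s s≤n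

    A B : Pred (Vertex G) 0ℓ
    A (inj₁ x) = toℕ x < s
    A (inj₂ _) = ⊥
    B (inj₁ _) = ⊥
    B (inj₂ y) = toℕ y < s + p
    A? : Decidable A
    A? (inj₁ x) = toℕ x <? s
    A? (inj₂ _) = no λ ()
    B? : Decidable B
    B? (inj₁ _) = no λ ()
    B? (inj₂ y) = toℕ y <? s + p

    A∩B=∅ : ∀ {x} → A x → ¬ B x
    A∩B=∅ {inj₁ _} _ ()

    closed : ∀ {x y} → Adj G x y → A x → A y ⊎ B y
    closed {inj₁ _} {inj₂ y} (inj₁ (_ , y<n∸t))       _   = inj₂ (subst (toℕ y <_) n∸t≡s+p y<n∸t)
    closed {inj₁ _} {inj₂ _} (inj₂ (inj₁ (s≤x , _))) x<s = ⊥-elim (<⇒≱ x<s s≤x)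
    closed {inj₁ _} {inj₂ _} (inj₂ (inj₂ (s≤x , _))) x<s = ⊥-elim (<⇒≱ x<s s≤x)

    independent : ∀ {x y} → Adj G x y → A x → ¬ A y
    independent {inj₁ _} {inj₂ _} _ _ ()

    W : Subset n
    W = interval n s p
    ∣W∣ : ∣ W ∣ ≡ p
    ∣W∣ = ∣interval∣ n s p (<⇒≤ s+p<n)

    i₀ : Fin n
    i₀ = fromℕ< 0<n
    i₀∉W : i₀ ∉ W
    i₀∉W = ∉-interval⁺ (inj₁ (subst (_< s) (sym (toℕ-fromℕ< 0<n)) 1≤s))
    B-end : B (inj₂ i₀)
    B-end = subst (_< s + p) (sym (toℕ-fromℕ< 0<n)) (≤-trans 1≤s (m≤m+n s p))

    c : Vertex G
    c = inj₂ (fromℕ< s+p<n)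
    c-alive : Alive G W W c
    c-alive = ∉-interval⁺ (inj₂ (≤-reflexive (sym (toℕ-fromℕ< s+p<n))))
    ¬Bc : ¬ B c
    ¬Bc = <-irrefl (toℕ-fromℕ< s+p<n)

    <s⇒alive-A : ∀ {x} → 0 ≤ toℕ x → toℕ x < 0 + s → Alive G W W (inj₁ x) × A (inj₁ x)
    <s⇒alive-A _ x<s = ∉-interval⁺ (inj₁ x<s) , x<s
    alive-B⇒<s : ∀ {w} → Alive G W W w → B w → ∃ λ y → w ≡ inj₂ y × 0 ≤ toℕ y × toℕ y < 0 + s
    alive-B⇒<s {inj₂ y} y∉W y<s+p with ∉-interval⁻ y∉W
    ... | inj₁ y<s   = y , refl , z≤n , y<s
    ... | inj₂ s+p≤y = ⊥-elim (<⇒≱ y<s+p s+p≤y)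

  ¬2p-HBBalanced-M : ¬ 2p-HBBalanced (M (s + t + p) (s + t + p) s t) p
  ¬2p-HBBalanced-M H = <-irrefl refl (begin-strict
    s                                     ≤⟨ s≤countA ⟩
    count A? vertices                     ≤⟨ path-count≤exits independent ⟩
    exits vertices                        ≤⟨ m≤n+m _ _ ⟩
    count B? [ inj₁ i₀ ] + exits vertices <⟨ path-exits<countB c c-alive (λ ()) ¬Bc ⟩
    count B? vertices                     ≤⟨ countB≤s ⟩
    s                                     ∎)
    where
    open ≤-Reasoning
    open OnHamPath G (H W W ∣W∣ ∣W∣ i₀ i₀ i₀∉W i₀∉W)
    open Separated A? B? A∩B=∅ closed B-end
    s≤countA : s ≤ count A? vertices
    s≤countA = interval≤path-count A? inj₁ s≤n inj₁-injective <s⇒alive-A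
    countB≤s : count B? vertices ≤ s
    countB≤s = path-count≤interval B? inj₂ s≤n alive-B⇒<s

module NearlyBalancedM (p s t n : ℕ) (1≤s : 1 ≤ s)
  (s+p+2≤n : s + p + 2 ≤ n) (t+p+1≤n : t + p + 1 ≤ n) (n≤s+t+p+1 : n ≤ s + t + p + 1) where

  private
    m = n ∸ 1
    G = M n m s t

    s+p+1<n : suc (s + p) < n
    s+p+1<n = subst (_≤ n) (+-comm (s + p) 2) s+p+2≤n
    s+p<n : s + p < n
    s+p<n = ≤-trans (n≤1+n _) s+p+1<n
    0<n : 0 < n
    0<n = ≤-trans (s≤s z≤n) s+p<n
    p+t≤m : p + t ≤ m
    p+t≤m = m+n≤o⇒m≤o∸n (p + t) (subst (λ k → k + 1 ≤ n) (+-comm t p) t+p+1≤n)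
    t≤m : t ≤ m
    t≤m = ≤-trans (m≤n+m t p) p+t≤m
    n∸[s+p]≤1+t : n ∸ (s + p) ≤ suc t
    n∸[s+p]≤1+t = m≤n+o⇒m∸n≤o n (s + p) (subst (n ≤_) s+t+p+1≡s+p+1+t n≤s+t+p+1)
      where
      open ≡-Reasoning
      s+t+p+1≡s+p+1+t : s + t + p + 1 ≡ s + p + suc t
      s+t+p+1≡s+p+1+t = begin
        s + t + p + 1   ≡⟨ cong (_+ 1) (xy∙z≈xz∙y s t p) ⟩
        s + p + t + 1   ≡⟨ +-assoc (s + p) t 1 ⟩
        s + p + (t + 1) ≡⟨ cong (s + p +_) (+-comm t 1) ⟩
        s + p + suc t   ∎

    A B : Pred (Vertex G) 0ℓ
    A (inj₁ _) = ⊥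
    A (inj₂ y) = m ∸ t ≤ toℕ y
    B (inj₁ x) = s ≤ toℕ x
    B (inj₂ _) = ⊥
    A? : Decidable A
    A? (inj₁ _) = no λ ()
    A? (inj₂ y) = m ∸ t ≤? toℕ y
    B? : Decidable B
    B? (inj₁ x) = s ≤? toℕ x
    B? (inj₂ _) = no λ ()

    A∩B=∅ : ∀ {x} → A x → ¬ B x
    A∩B=∅ {inj₂ _} _ ()

    closed : ∀ {x y} → Adj G x y → A x → A y ⊎ B y
    closed {inj₂ _} {inj₁ _} (inj₁ (_ , y<m∸t))       m∸t≤y = ⊥-elim (<⇒≱ y<m∸t m∸t≤y)
    closed {inj₂ _} {inj₁ _} (inj₂ (inj₁ (s≤x , _))) _     = inj₂ s≤x
    closed {inj₂ _} {inj₁ _} (inj₂ (inj₂ (s≤x , _))) _     = inj₂ s≤x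

    independent : ∀ {x y} → Adj G x y → A x → ¬ A y
    independent {inj₂ _} {inj₁ _} _ _ ()

    WX : Subset n
    WX = interval n s p
    WY : Subset m
    WY = interval m 0 p
    ∣WX∣ : ∣ WX ∣ ≡ p
    ∣WX∣ = ∣interval∣ n s p (<⇒≤ s+p<n)
    ∣WY∣ : ∣ WY ∣ ≡ p
    ∣WY∣ = ∣interval∣ m 0 p (≤-trans (m≤m+n p t) p+t≤m)

    u v : Fin n
    u = fromℕ< s+p<n
    v = fromℕ< s+p+1<n
    u≢v : u ≢ v
    u≢v u≡v = 1+n≢n (trans (sym (toℕ-fromℕ< s+p+1<n)) (trans (cong toℕ (sym u≡v)) (toℕ-fromℕ< s+p<n)))
    s+p≤u : s + p ≤ toℕ u
    s+p≤u = ≤-reflexive (sym (toℕ-fromℕ< s+p<n))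
    s+p≤v : s + p ≤ toℕ v
    s+p≤v = ≤-trans (n≤1+n _) (≤-reflexive (sym (toℕ-fromℕ< s+p+1<n)))
    u∉WX : u ∉ WX
    u∉WX = ∉-interval⁺ (inj₂ s+p≤u)
    v∉WX : v ∉ WX
    v∉WX = ∉-interval⁺ (inj₂ s+p≤v)
    Bu : B (inj₁ u)
    Bu = ≤-trans (m≤m+n s p) s+p≤u
    Bv : B (inj₁ v)
    Bv = ≤-trans (m≤m+n s p) s+p≤v

    c : Fin n
    c = fromℕ< 0<n
    c<s : toℕ c < s
    c<s = subst (_< s) (sym (toℕ-fromℕ< 0<n)) 1≤s
    c-alive : Alive G WX WY (inj₁ c)
    c-alive = ∉-interval⁺ (inj₁ c<s)

    ≥m∸t⇒alive-A : ∀ {y} → m ∸ t ≤ toℕ y → toℕ y < m ∸ t + t → Alive G WX WY (inj₂ y) × A (inj₂ y)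
    ≥m∸t⇒alive-A m∸t≤y _ = ∉-interval⁺ (inj₂ (≤-trans (m+n≤o⇒m≤o∸n p p+t≤m) m∸t≤y)) , m∸t≤y
    alive-B⇒≥s+p : ∀ {w} → Alive G WX WY w → B w →
                   ∃ λ x → w ≡ inj₁ x × s + p ≤ toℕ x × toℕ x < s + p + (n ∸ (s + p))
    alive-B⇒≥s+p {inj₁ x} x∉WX s≤x with ∉-interval⁻ x∉WX
    ... | inj₁ x<s   = ⊥-elim (<⇒≱ x<s s≤x)
    ... | inj₂ s+p≤x = x , refl , s+p≤x , subst (toℕ x <_) (sym (m+[n∸m]≡n (<⇒≤ s+p<n))) (toℕ<n x)

  ¬2p-HBNearly-M : ¬ 2p-HBNearly (M n (n ∸ 1) s t) p
  ¬2p-HBNearly-M H = <-irrefl refl (begin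
    2 + t                                      ≤⟨ +-monoʳ-≤ 2 t≤countA ⟩
    2 + count A? vertices                      ≤⟨ +-monoʳ-≤ 2 (path-count≤exits independent) ⟩
    2 + exits vertices                         ≡⟨ cong (λ k → suc (k + exits vertices)) (count-[]≡1 B? Bu) ⟨
    suc (count B? [ inj₁ u ] + exits vertices) ≤⟨ path-exits<countB (inj₁ c) c-alive (λ ()) (<⇒≱ c<s) ⟩
    count B? vertices                          ≤⟨ countB≤n∸[s+p] ⟩
    n ∸ (s + p)                                ≤⟨ n∸[s+p]≤1+t ⟩
    1 + t                                      ∎)
    where
    open ≤-Reasoning
    open OnHamPath G (H WX WY ∣WX∣ ∣WY∣ u v u≢v u∉WX v∉WX)
    open Separated A? B? A∩B=∅ closed Bv
    t≤countA : t ≤ count A? vertices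
    t≤countA = interval≤path-count A? inj₂ (≤-reflexive (m∸n+n≡m t≤m)) inj₂-injective ≥m∸t⇒alive-A
    countB≤n∸[s+p] : count B? vertices ≤ n ∸ (s + p)
    countB≤n∸[s+p] = path-count≤interval B? inj₁ (≤-reflexive (m+[n∸m]≡n (<⇒≤ s+p<n))) alive-B⇒≥s+p

module BalancedN (p n : ℕ) (p+3≤n : p + 3 ≤ n) where

  private
    G = N n p
    q = n ∸ p ∸ 2

    n≡2+q+p : n ≡ 2 + (q + p)
    n≡2+q+p = begin
      n                     ≡⟨ m∸n+n≡m (≤-trans (+-monoʳ-≤ p (n≤1+n 2)) p+3≤n) ⟨
      n ∸ (p + 2) + (p + 2) ≡⟨ cong (_+ (p + 2)) (∸-+-assoc n p 2) ⟨
      q + (p + 2)           ≡⟨ +-assoc q p 2 ⟨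
      q + p + 2             ≡⟨ +-comm (q + p) 2 ⟩
      2 + (q + p)           ∎
      where open ≡-Reasoning
    n∸1≡1+q+p : n ∸ 1 ≡ suc (q + p)
    n∸1≡1+q+p = cong (_∸ 1) n≡2+q+p
    0<q : 0 < q
    0<q = +-cancelʳ-≤ p 1 q (s≤s⁻¹ (s≤s⁻¹ (subst (3 + p ≤_) n≡2+q+p (subst (_≤ n) (+-comm p 3) p+3≤n))))
    q+p<n∸1 : q + p < n ∸ 1
    q+p<n∸1 = subst (q + p <_) (sym n∸1≡1+q+p) (n<1+n (q + p))
    n∸1<n : n ∸ 1 < n
    n∸1<n = subst₂ _<_ (sym n∸1≡1+q+p) (sym n≡2+q+p) (n<1+n _)
    0<n∸1 : 0 < n ∸ 1
    0<n∸1 = subst (0 <_) (sym n∸1≡1+q+p) (s≤s z≤n)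

    Part1∩Part3=∅ : ∀ {k} {i : Fin k} → Part1 n p i → ¬ Part3 n p i
    Part1∩Part3=∅ i<q n∸1≤i = <⇒≱ i<q (≤-trans (<⇒≤ (≤-trans (s≤s (m≤m+n q p)) q+p<n∸1)) n∸1≤i)
    Part2∩Part3=∅ : ∀ {k} {i : Fin k} → Part2 n p i → ¬ Part3 n p i
    Part2∩Part3=∅ (_ , i<n∸1) n∸1≤i = <⇒≱ i<n∸1 n∸1≤i

    A B : Pred (Vertex G) 0ℓ
    A (inj₁ x) = Part3 n p x
    A (inj₂ y) = Part3 n p y
    B (inj₁ x) = Part2 n p x
    B (inj₂ y) = Part2 n p y
    A? : Decidable A
    A? (inj₁ x) = n ∸ 1 ≤? toℕ x
    A? (inj₂ y) = n ∸ 1 ≤? toℕ y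
    B? : Decidable B
    B? (inj₁ x) = (q ≤? toℕ x) ×-dec (toℕ x <? n ∸ 1)
    B? (inj₂ y) = (q ≤? toℕ y) ×-dec (toℕ y <? n ∸ 1)

    A∩B=∅ : ∀ {x} → A x → ¬ B x
    A∩B=∅ {inj₁ _} x₃ x₂ = Part2∩Part3=∅ x₂ x₃
    A∩B=∅ {inj₂ _} y₃ y₂ = Part2∩Part3=∅ y₂ y₃

    closed : ∀ {x y} → Adj G x y → A x → A y ⊎ B y
    closed {inj₁ _} {inj₂ _} (inj₁ (x₁ , _))              x₃ = ⊥-elim (Part1∩Part3=∅ x₁ x₃)
    closed {inj₁ _} {inj₂ _} (inj₂ (inj₁ (x₂ , _)))       x₃ = ⊥-elim (Part2∩Part3=∅ x₂ x₃)
    closed {inj₁ _} {inj₂ _} (inj₂ (inj₂ (_ , inj₁ y₂))) _  = inj₂ y₂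
    closed {inj₁ _} {inj₂ _} (inj₂ (inj₂ (_ , inj₂ y₃))) _  = inj₁ y₃
    closed {inj₂ _} {inj₁ _} (inj₁ (_ , inj₁ y₁))        y₃ = ⊥-elim (Part1∩Part3=∅ y₁ y₃)
    closed {inj₂ _} {inj₁ _} (inj₁ (_ , inj₂ y₂))        y₃ = ⊥-elim (Part2∩Part3=∅ y₂ y₃)
    closed {inj₂ _} {inj₁ _} (inj₂ (inj₁ (x₂ , _)))       _  = inj₂ x₂
    closed {inj₂ _} {inj₁ _} (inj₂ (inj₂ (x₃ , _)))       _  = inj₁ x₃

    W : Subset n
    W = interval n q p
    ∣W∣ : ∣ W ∣ ≡ p
    ∣W∣ = ∣interval∣ n q p (≤-trans (<⇒≤ q+p<n∸1) (<⇒≤ n∸1<n))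

    w last first : Fin n
    w = fromℕ< (<-trans q+p<n∸1 n∸1<n)
    last = fromℕ< n∸1<n
    first = fromℕ< (<-trans 0<n∸1 n∸1<n)
    toℕw≡q+p : toℕ w ≡ q + p
    toℕw≡q+p = toℕ-fromℕ< (<-trans q+p<n∸1 n∸1<n)
    toℕfirst≡0 : toℕ first ≡ 0
    toℕfirst≡0 = toℕ-fromℕ< (<-trans 0<n∸1 n∸1<n)

    w∉W : w ∉ W
    w∉W = ∉-interval⁺ (inj₂ (≤-reflexive (sym toℕw≡q+p)))
    Part2-w : Part2 n p w
    Part2-w = subst (q ≤_) (sym toℕw≡q+p) (m≤m+n q p) , subst (_< n ∸ 1) (sym toℕw≡q+p) q+p<n∸1

    Part2∖W≡w : ∀ {x} → x ∉ W → Part2 n p x → x ≡ w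
    Part2∖W≡w {x} x∉W (q≤x , x<n∸1) with ∉-interval⁻ x∉W
    ... | inj₁ x<q   = ⊥-elim (<⇒≱ x<q q≤x)
    ... | inj₂ q+p≤x = toℕ-injective (trans (≤-antisym (s≤s⁻¹ (subst (toℕ x <_) n∸1≡1+q+p x<n∸1)) q+p≤x)
                                            (sym toℕw≡q+p))
    alive-B⇒end : ∀ {z} → Alive G W W z → B z → z ∈ inj₁ w ∷ inj₂ w ∷ []
    alive-B⇒end {inj₁ x} x∉W x₂ rewrite Part2∖W≡w x∉W x₂ = here refl
    alive-B⇒end {inj₂ y} y∉W y₂ rewrite Part2∖W≡w y∉W y₂ = there (here refl)

    A-last : A (inj₁ last)
    A-last = ≤-reflexive (sym (toℕ-fromℕ< n∸1<n))
    last-alive : Alive G W W (inj₁ last)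
    last-alive = ∉-interval⁺ (inj₂ (subst (q + p ≤_) (sym (toℕ-fromℕ< n∸1<n)) (<⇒≤ q+p<n∸1)))
    first-alive : Alive G W W (inj₁ first)
    first-alive = ∉-interval⁺ (inj₁ (subst (_< q) (sym toℕfirst≡0) 0<q))
    ¬A-first : ¬ A (inj₁ first)
    ¬A-first n∸1≤0 = <⇒≱ 0<n∸1 (subst (n ∸ 1 ≤_) toℕfirst≡0 n∸1≤0)
    ¬B-first : ¬ B (inj₁ first)
    ¬B-first (q≤0 , _) = <⇒≱ 0<q (subst (q ≤_) toℕfirst≡0 q≤0)

  ¬2p-HBBalanced-N : ¬ 2p-HBBalanced (N n p) p
  ¬2p-HBBalanced-N H = <-irrefl refl (begin
    3                                          ≤⟨ +-monoʳ-≤ 2 (path-0<exits (inj₁ last) last-alive A-last) ⟩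
    2 + exits vertices                         ≡⟨ cong (λ k → suc (k + exits vertices)) count-[w]≡1 ⟨
    suc (count B? [ inj₁ w ] + exits vertices) ≤⟨ path-exits<countB (inj₁ first) first-alive ¬A-first ¬B-first ⟩
    count B? vertices                          ≤⟨ path-count≤length B? (inj₁ w ∷ inj₂ w ∷ []) alive-B⇒end ⟩
    2                                          ∎)
    where
    open ≤-Reasoning
    open OnHamPath G (H W W ∣W∣ ∣W∣ w w w∉W w∉W)
    open Separated A? B? A∩B=∅ closed Part2-w
    count-[w]≡1 : count B? [ inj₁ w ] ≡ 1
    count-[w]≡1 = count-[]≡1 B? {inj₁ w} Part2-w

lemma2p8 : ((p s t n : ℕ) → 1 ≤ s → 1 ≤ t →
    (s + p + 2) ⊔ (t + p + 2) ≤ n → n ≤ s + t + p + 1 →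
    ¬ 2p-HBNearly (M n (n ∸ 1) s t) p)
  × ((p s t n : ℕ) → 1 ≤ s → 1 ≤ t → n ≡ s + t + p →
    ¬ 2p-HBBalanced (M n n s t) p)
  × ((p n : ℕ) → p + 6 ≤ n → ¬ 2p-HBBalanced (N n p) p)
lemma2p8 =
    (λ p s t n 1≤s _ max≤n n≤s+t+p+1 →
      NearlyBalancedM.¬2p-HBNearly-M p s t n 1≤s (≤-trans (m≤m⊔n _ _) max≤n)
        (≤-trans (+-monoʳ-≤ (t + p) (n≤1+n 1)) (≤-trans (m≤n⊔m _ _) max≤n)) n≤s+t+p+1)
  , (λ { p s t _ 1≤s 1≤t refl → BalancedM.¬2p-HBBalanced-M p s t 1≤s 1≤t })
  , (λ p n p+6≤n → BalancedN.¬2p-HBBalanced-N p n (≤-trans (+-monoʳ-≤ p (m≤m+n 3 3)) p+6≤n))
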